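{- Assume the setting described in the context. Let $I \subseteq \{1,\ldots,s\}$ and define \[ f_I = h + \sum_{i \in I} g_i x_i \in \mathbf{F}_q[(x_i)_{i \in I}, y, z]. \] Then $\sigma(f) \leq \sigma(f_I) + s - \#I$. In particular $\sigma(f) \leq \sigma(h) + s$.
   Context: Setting: $\mathbf{F}_q$ is a finite field; $x = (x_1,\ldots,x_s)$, $y=(y_1,\ldots,y_t)$, $z = (z_1,\ldots,z_r)$ are variables with $s,t \geq 0$, $r \geq 1$, $n = s+t+r$. $f \in \mathbf{F}_q[x,y,z]$ is non-degenerate with respect to the faces of its Newton polyhedron at the origin (for every non-empty face $\tau$ of $\Delta_0(f) = \mathrm{conv}(\mathrm{supp} f)+\mathbf{R}^n_{\geq 0}$, the partial derivatives of $f_\tau$, the sum of the terms of $f$ with exponent in $\tau$, have no common zero in $(\overline{\mathbf{F}}_q^\ast)^n$). There are an integer $b>0$ and integers $w_1,\ldots,w_t$ with $0 < w_j < b$ such that, assigning weight $b$ to each $x_i$, weight $w_j$ to $y_j$ and weight $0$ to each $z_\ell$, every monomial of $f$ has weighted degree $b$; moreover $r$ is maximal, i.e. $\mathrm{supp} f$ is not contained in any hyperplane $\sum_j c_j i_j = b'$ with $b' > 0$, $c_j \in \mathbf{Z}_{\geq 0}$, having more than $r$ coefficients $c_j$ equal to $0$; $\mathrm{char}\,\mathbf{F}_q \nmid b$. Write $f = h + g_1 x_1 + \cdots + g_s x_s$ with $g_1,\ldots,g_s \in \mathbf{F}_q[z]\setminus\{0\}$ and $h \in \mathbf{F}_q[y,z]$.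 For a polynomial $u$ (in any set of variables), $\sigma(u)$ is the supremum of the $\sigma > 0$ with $(1/\sigma,\ldots,1/\sigma) \in \Delta_0(u)$, with $\sigma(0) = 0$. -}

module Defs where

open import Level using (0ℓ)
open import Algebra.Bundles using (CommutativeRing)
open import Algebra.Morphism.Structures using (IsRingHomomorphism)
open import Data.Bool using (Bool; true; false; _∧_; _∨_; if_then_else_)
open import Data.Nat as ℕ using (ℕ; zero; suc; _+_; _∸_)
open import Data.Fin as Fin using (Fin)
open import Data.Fin.Subset using (Subset; inside)
open import Data.Vec as Vec using (Vec; lookup; take; drop; replicate; _[_]≔_; _[_]%=_)
open import Data.List as List using (List; []; _∷_; map; filterᵇ; allFin)
open import Data.List.Relation.Unary.All using (All)
open import Data.Vec.Relation.Unary.All using () renaming (All to VAll)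
open import Data.Fin.Subset.Properties using (_∈?_)
open import Relation.Nullary using (does)
open import Data.List.Relation.Unary.Any using (Any)
open import Data.List.Relation.Unary.Unique.Propositional using (Unique)
open import Data.List.Membership.Propositional using (_∈_)
open import Data.Integer using (+_)
open import Data.Rational as ℚ using (ℚ; _/_)
open import Data.Product using (Σ; ∃; _×_; _,_; proj₁; proj₂)
open import Data.Sum using (_⊎_)
open import Relation.Nullary using (¬_)
open import Relation.Binary.PropositionalEquality using (_≡_)

record FiniteField : Set₁ where
  field
    commRing : CommutativeRing 0ℓ 0ℓ
  open CommutativeRing commRing public
  field
    0≉1      : ¬ (0# ≈ 1#)
    inverse  : ∀ x → ¬ (x ≈ 0#) → ∃ λ y → (x * y) ≈ 1#
    elements : List Carrier
    complete : ∀ x → Any (x ≈_) elements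

module _ (K : FiniteField) where
  open FiniteField K renaming (_+_ to _⊕_)

  _·_ : ℕ → Carrier → Carrier
  zero  · a = 0#
  suc n · a = a ⊕ (n · a)

  _^_ : Carrier → ℕ → Carrier
  a ^ zero  = 1#
  a ^ suc n = a * (a ^ n)

  CharNotDividing : ℕ → Set
  CharNotDividing b = ¬ ((b · 1#) ≈ 0#)

-- Every finite subextension of an algebraic closure of K is of this form and
-- conversely, so "∃ a point of (F̄_q^*)^n" = "∃ such L and a point of (L^*)^n".
record Extension (K : FiniteField) : Set₁ where
  field
    L     : FiniteField
    φ     : FiniteField.Carrier K → FiniteField.Carrier L
    isHom : IsRingHomomorphism (FiniteField.rawRing K) (FiniteField.rawRing L) φ

Exp : ℕ → Set
Exp n = Vec ℕ n

Terms : FiniteField → ℕ → Set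
Terms K n = List (Exp n × FiniteField.Carrier K)

record Poly (K : FiniteField) (n : ℕ) : Set where
  field
    terms          : Terms K n
    coeffs-nonzero : All (λ m → ¬ (FiniteField._≈_ K (proj₂ m) (FiniteField.0# K))) terms
    exps-distinct  : Unique (map proj₁ terms)

supp : ∀ {K n} → Terms K n → List (Exp n)
supp = map proj₁

dot : ∀ {k} → Vec ℕ k → Vec ℕ k → ℕ
dot u v = Vec.sum (Vec.zipWith ℕ._*_ u v)

-- Faces of the Newton polyhedron Δ₀(f) = conv(supp f) + ℝ≥0^n.
-- The non-empty faces are exactly the sets of points of Δ₀ minimising
-- ⟨a,-⟩ for a weight vector a ∈ ℕ^n (rational polyhedron); f_τ keeps the
-- terms whose exponent minimises ⟨a,-⟩ on supp f.

faceTerms : ∀ {K n} → Vec ℕ n → Terms K n → Terms K n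
faceTerms {K} a ts =
  filterᵇ (λ m → List.foldr (λ e acc → (dot a (proj₁ m) ℕ.≤ᵇ dot a e) ∧ acc) true (supp {K} ts)) ts

module _ (E : FiniteField) where
  open FiniteField E renaming (_+_ to _⊕_)

  monomial : ∀ {n} → Exp n → Vec Carrier n → Carrier
  monomial e p = Vec.foldr _ _*_ 1# (Vec.zipWith (_^_ E) p e)

  sumL : List Carrier → Carrier
  sumL = List.foldr _⊕_ 0#

evalPartial : ∀ {K n} (Ex : Extension K) → Fin n → Terms K n →
              Vec (FiniteField.Carrier (Extension.L Ex)) n →
              FiniteField.Carrier (Extension.L Ex)
evalPartial {K} Ex i ts p =
  sumL L (map (λ m → FiniteField._*_ L
                       (_·_ L (lookup (proj₁ m) i) (φ (proj₂ m)))
                       (monomial L (proj₁ m [ i ]%= ℕ.pred) p)) ts)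
  where open Extension Ex

NonDegenerate : ∀ {K n} → Poly K n → Set₁
NonDegenerate {K} {n} f =
  (Ex : Extension K) (a : Vec ℕ n)
  (p : Vec (FiniteField.Carrier (Extension.L Ex)) n) →
  VAll (λ c → ¬ (FiniteField._≈_ (Extension.L Ex) c (FiniteField.0# (Extension.L Ex)))) p →
  ¬ (∀ i → FiniteField._≈_ (Extension.L Ex)
              (evalPartial Ex i (faceTerms {K} a (Poly.terms f)) p)
              (FiniteField.0# (Extension.L Ex)))

xpart : ∀ {s t r} → Exp (s + t + r) → Vec ℕ s
xpart {s} {t} e = take s (take (s + t) e)

ypart : ∀ {s t r} → Exp (s + t + r) → Vec ℕ t
ypart {s} {t} e = drop s (take (s + t) e)

zpart : ∀ {s t r} → Exp (s + t + r) → Vec ℕ r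
zpart {s} {t} e = drop (s + t) e

unitVec : ∀ {s} → Fin s → Vec ℕ s
unitVec {s} i = replicate s 0 [ i ]≔ 1

WeightedHomogeneous : ∀ {K s t r} → ℕ → Vec ℕ t → Poly K (s + t + r) → Set
WeightedHomogeneous {K} {s} {t} {r} b w f =
  All (λ e → b ℕ.* Vec.sum (xpart {s} {t} {r} e) + dot w (ypart {s} {t} {r} e) ≡ b)
      (supp {K} (Poly.terms f))

RMaximal : ∀ {K s t r} → Poly K (s + t + r) → Set
RMaximal {K} {s} {t} {r} f =
  (c : Vec ℕ (s + t + r)) (b' : ℕ) → 0 ℕ.< b' →
  All (λ e → dot c e ≡ b') (supp {K} (Poly.terms f)) →
  Vec.count (ℕ._≟ 0) c ℕ.≤ r

isZeroVec : ∀ {k} → Vec ℕ k → Bool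
isZeroVec v = Vec.foldr _ (λ a acc → (a ℕ.≡ᵇ 0) ∧ acc) true v

isUnitAt : ∀ {k} → Fin k → Vec ℕ k → Bool
isUnitAt i v = isZeroVec (v [ i ]%= ℕ.pred) ∧ (lookup v i ℕ.≡ᵇ 1)

hTerms : ∀ {K s t r} → Poly K (s + t + r) → Terms K (s + t + r)
hTerms {s = s} {t} {r} f =
  filterᵇ (λ m → isZeroVec (xpart {s} {t} {r} (proj₁ m))) (Poly.terms f)

gxTerms : ∀ {K s t r} → Fin s → Poly K (s + t + r) → Terms K (s + t + r)
gxTerms {s = s} {t} {r} i f =
  filterᵇ (λ m → isUnitAt i (xpart {s} {t} {r} (proj₁ m))) (Poly.terms f)

fI : ∀ {K s t r} → Subset s → Poly K (s + t + r) → Terms K (s + t + r)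
fI {K} {s} {t} {r} I f =
  hTerms {K} {s} {t} {r} f List.++ List.concatMap (λ i → if does (i ∈? I) then gxTerms {K} {s} {t} {r} i f else [])
                                  (allFin s)

-- σ(u) = sup { σ > 0 | (1/σ,…,1/σ) ∈ Δ₀(u) }, σ(0) = 0.

ℕ→ℚ : ℕ → ℚ
ℕ→ℚ k = + k / 1

sumℚ : List ℚ → ℚ
sumℚ = List.foldr ℚ._+_ ℚ.0ℚ

-- σ > 0 and (1/σ,…,1/σ) ∈ conv(S) + ℝ≥0^n, i.e. there is a convex
-- combination v = Σ λ_k e_k of points e_k ∈ S with v_j ≤ 1/σ for all j.
DiagIn : ∀ {n} → List (Exp n) → ℚ → Set
DiagIn {n} S σ =
  ℚ.0ℚ ℚ.< σ ×
  Σ (List (ℚ × Exp n)) λ ws →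
    All (λ m → (ℚ.0ℚ ℚ.≤ proj₁ m) × (proj₂ m ∈ S)) ws ×
    sumℚ (map proj₁ ws) ≡ ℚ.1ℚ ×
    (∀ j → σ ℚ.* sumℚ (map (λ m → proj₁ m ℚ.* ℕ→ℚ (lookup (proj₂ m) j)) ws) ℚ.≤ ℚ.1ℚ)

-- σ(S) ≤ σ(T) + k, for the Newton polyhedra of supports S, T.
-- (Δ₀ is a rational polyhedron, so each supremum is either +∞ or attained
-- at a rational σ; unfolding the supremum gives:)
SigmaLE : ∀ {n} → List (Exp n) → List (Exp n) → ℚ → Set
SigmaLE S T k =
  ∀ σ → DiagIn S σ →
  (σ ℚ.≤ k) ⊎ (∃ λ σ' → DiagIn T σ' × (σ ℚ.≤ σ' ℚ.+ k))

-- f = h + g_1 x_1 + ⋯ + g_s x_s with h ∈ F_q[y,z] and g_i ∈ F_q[z] ∖ {0}: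
-- every monomial of f either has no x, or is x_i times a monomial in z only;
-- and each g_i is nonzero.
Decomposition : ∀ {K s t r} → Poly K (s + t + r) → Set
Decomposition {K} {s} {t} {r} f =
  All (λ e → (xpart {s} {t} {r} e ≡ replicate s 0) ⊎
             (∃ λ i → (xpart {s} {t} {r} e ≡ unitVec i) × (ypart {s} {t} {r} e ≡ replicate t 0)))
      (supp {K} (Poly.terms f)) ×
  (∀ i → Any (λ e → xpart {s} {t} {r} e ≡ unitVec i) (supp {K} (Poly.terms f)))

{-# OPTIONS --safe #-}

-- A point (1/σ,…,1/σ) of Δ₀(f) dominates a convex combination of exponents of f.
-- The exponents of f missing from f_I are those of the terms of g_i x_i with i ∉ I,
-- whose x_i-coordinate is 1, while every x_i-coordinate of the combination is at
-- most 1/σ; so the total weight D on them satisfies σD ≤ s − #I. Renormalising the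
-- remaining weight 1 − D puts (1/σ',…,1/σ') in Δ₀(f_I) for σ' = σ(1 − D), hence
-- σ ≤ σ' + s − #I (or σ ≤ s − #I when D = 1).

module Submission where

open import Defs
open import Data.Nat using (ℕ; _+_; _∸_; _<_; _≤_)
open import Data.Vec using (Vec)
open import Data.Vec.Relation.Unary.All using (All)
open import Data.Fin.Subset using (Subset; ∣_∣)
open import Data.Product using (_×_)

open import Function using (_∘_)
open import Data.Nat as ℕ using (suc)
import Data.Nat.Properties as ℕP
import Data.Nat.Coprimality as Coprimality
open import Data.Integer as ℤ using (+_)
import Data.Integer.Properties as ℤP
open import Data.Rational as ℚ using (ℚ; mkℚ; 0ℚ; 1ℚ; 1/_)
import Data.Rational.Properties as ℚP
open import Algebra.Bundles using (CommutativeMonoid)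
import Algebra.Properties.CommutativeSemigroup as CommSemigroupProperties
open import Data.Bool using (Bool; T; T?; if_then_else_)
import Data.Bool.Properties as BoolP
open import Function.Bundles using (Equivalence)
open import Data.Unit using (tt)
open import Data.Fin as Fin using (Fin)
open import Data.Fin.Subset as Sub using (inside; outside; ∁; ⊥)
import Data.Fin.Subset.Properties as SubP
open import Data.Vec as Vec using (lookup; replicate)
import Data.Vec.Properties as VecP
open import Data.List as List using (List; []; _∷_; map; length; filter; filterᵇ)
import Data.List.Properties as ListP
open import Data.List.Relation.Unary.All as LAll using ([]; _∷_) renaming (All to LAll)
import Data.List.Relation.Unary.All.Properties as LAllP
import Data.List.Relation.Unary.Any.Properties as AnyP
open import Data.List.Relation.Unary.Any as Any using (Any; here; there)
open import Data.List.Membership.Propositional using (_∈_; _∉_)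
import Data.List.Membership.Propositional.Properties as ∈P
import Data.List.Membership.DecPropositional as DecMembership
open import Data.List.Relation.Binary.Subset.Propositional using (_⊆_)
import Data.List.Relation.Binary.Subset.Propositional.Properties as ⊆P
open import Data.Product using (∃; _,_; proj₁; proj₂)
open import Data.Sum using (_⊎_; inj₁; inj₂)
open import Relation.Nullary using (Dec; yes; no; does; ¬?; contradiction)
open import Relation.Nullary.Decidable using (dec-true)
open import Relation.Unary using (Decidable)
open import Relation.Binary.PropositionalEquality

module ℚ+ = CommSemigroupProperties (CommutativeMonoid.commutativeSemigroup ℚP.+-0-commutativeMonoid)
module ℚ* = CommSemigroupProperties (CommutativeMonoid.commutativeSemigroup ℚP.*-1-commutativeMonoid)

-- ℕ→ℚ k is a normalised quotient, which does not compute for a variable k.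
ℕ→ℚ≡mkℚ : ∀ k → ℕ→ℚ k ≡ mkℚ (+ k) 0 (Coprimality.sym (Coprimality.1-coprimeTo k))
ℕ→ℚ≡mkℚ k = ℚP.↥p/↧p≡p _

ℕ→ℚ-suc : ∀ k → ℕ→ℚ (suc k) ≡ 1ℚ ℚ.+ ℕ→ℚ k
ℕ→ℚ-suc k = trans (cong (λ z → (+ 1 ℤ.+ z) ℚ./ 1) (sym (ℤP.*-identityʳ (+ k))))
                  (cong₂ ℚ._+_ (sym (ℕ→ℚ≡mkℚ 1)) (sym (ℕ→ℚ≡mkℚ k)))

ℕ→ℚ-nonNeg : ∀ k → 0ℚ ℚ.≤ ℕ→ℚ k
ℕ→ℚ-nonNeg k = ℚP.nonNegative⁻¹ _ {{ℚP.normalize-nonNeg k 1}}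

*-nonNeg : ∀ {p q} → 0ℚ ℚ.≤ p → 0ℚ ℚ.≤ q → 0ℚ ℚ.≤ p ℚ.* q
*-nonNeg {p} {q} 0≤p 0≤q =
  ℚP.nonNegative⁻¹ _ {{ℚP.nonNeg*nonNeg⇒nonNeg p {{ℚ.nonNegative 0≤p}} q {{ℚ.nonNegative 0≤q}}}}

p≤q⇒p≤r+q : ∀ {p q r} → 0ℚ ℚ.≤ r → p ℚ.≤ q → p ℚ.≤ r ℚ.+ q
p≤q⇒p≤r+q {p} {q} {r} 0≤r p≤q = subst (ℚ._≤ r ℚ.+ q) (ℚP.+-identityˡ p) (ℚP.+-mono-≤ 0≤r p≤q)

p≤q⇒p≤q+r : ∀ {p q r} → 0ℚ ℚ.≤ r → p ℚ.≤ q → p ℚ.≤ q ℚ.+ r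
p≤q⇒p≤q+r {p} {q} {r} 0≤r p≤q = subst (ℚ._≤ q ℚ.+ r) (ℚP.+-identityʳ p) (ℚP.+-mono-≤ p≤q 0≤r)

1≤ℕ→ℚ : ∀ {k} → 1 ≤ k → 1ℚ ℚ.≤ ℕ→ℚ k
1≤ℕ→ℚ {suc k} _ = subst (1ℚ ℚ.≤_) (sym (ℕ→ℚ-suc k)) (p≤q⇒p≤q+r (ℕ→ℚ-nonNeg k) ℚP.≤-refl)

module _ {A : Set} where

  sumℚ-nonNeg : ∀ (f : A → ℚ) {xs} → LAll (λ x → 0ℚ ℚ.≤ f x) xs → 0ℚ ℚ.≤ sumℚ (map f xs)
  sumℚ-nonNeg f []           = ℚP.≤-refl
  sumℚ-nonNeg f (0≤fx ∷ 0≤f) = p≤q⇒p≤r+q 0≤fx (sumℚ-nonNeg f 0≤f)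

  sumℚ-mono-≤ : ∀ {f g : A → ℚ} {xs} → LAll (λ x → f x ℚ.≤ g x) xs →
                sumℚ (map f xs) ℚ.≤ sumℚ (map g xs)
  sumℚ-mono-≤ []           = ℚP.≤-refl
  sumℚ-mono-≤ (fx≤gx ∷ f≤g) = ℚP.+-mono-≤ fx≤gx (sumℚ-mono-≤ f≤g)

  sumℚ-map-+ : ∀ (f g : A → ℚ) xs →
               sumℚ (map (λ x → f x ℚ.+ g x) xs) ≡ sumℚ (map f xs) ℚ.+ sumℚ (map g xs)
  sumℚ-map-+ f g []       = sym (ℚP.+-identityʳ 0ℚ)
  sumℚ-map-+ f g (x ∷ xs) = trans (cong ((f x ℚ.+ g x) ℚ.+_) (sumℚ-map-+ f g xs))
                                  (ℚ+.interchange (f x) (g x) (sumℚ (map f xs)) (sumℚ (map g xs)))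

  sumℚ-map-*ʳ : ∀ (f : A → ℚ) c xs → sumℚ (map (λ x → f x ℚ.* c) xs) ≡ sumℚ (map f xs) ℚ.* c
  sumℚ-map-*ʳ f c []       = sym (ℚP.*-zeroˡ c)
  sumℚ-map-*ʳ f c (x ∷ xs) = trans (cong (f x ℚ.* c ℚ.+_) (sumℚ-map-*ʳ f c xs))
                                   (sym (ℚP.*-distribʳ-+ c (f x) (sumℚ (map f xs))))

  *-sumℚ≤length : ∀ {c} (f : A → ℚ) → (∀ x → c ℚ.* f x ℚ.≤ 1ℚ) →
                  ∀ xs → c ℚ.* sumℚ (map f xs) ℚ.≤ ℕ→ℚ (length xs)
  *-sumℚ≤length {c} f cf≤1 []       = ℚP.≤-reflexive (ℚP.*-zeroʳ c)
  *-sumℚ≤length {c} f cf≤1 (x ∷ xs) =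
    subst₂ ℚ._≤_ (sym (ℚP.*-distribˡ-+ c (f x) (sumℚ (map f xs)))) (sym (ℕ→ℚ-suc (length xs)))
      (ℚP.+-mono-≤ (cf≤1 x) (*-sumℚ≤length {c} f cf≤1 xs))

  module _ {P : A → Set} (P? : Decidable P) (f : A → ℚ) where

    sumℚ-filter-split : ∀ xs → sumℚ (map f xs) ≡
                        sumℚ (map f (filter P? xs)) ℚ.+ sumℚ (map f (filter (¬? ∘ P?) xs))
    sumℚ-filter-split []       = sym (ℚP.+-identityʳ 0ℚ)
    sumℚ-filter-split (x ∷ xs) with P? x
    ... | yes _ = trans (cong (f x ℚ.+_) (sumℚ-filter-split xs)) (sym (ℚP.+-assoc (f x) _ _))
    ... | no _  = trans (cong (f x ℚ.+_) (sumℚ-filter-split xs))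
                        (ℚ+.x∙yz≈y∙xz (f x) (sumℚ (map f (filter P? xs))) (sumℚ (map f (filter (¬? ∘ P?) xs))))

    sumℚ-filter-≤ : ∀ {xs} → LAll (λ x → 0ℚ ℚ.≤ f x) xs → sumℚ (map f (filter P? xs)) ℚ.≤ sumℚ (map f xs)
    sumℚ-filter-≤ {[]}     []           = ℚP.≤-refl
    sumℚ-filter-≤ {x ∷ xs} (0≤fx ∷ 0≤f) with P? x
    ... | yes _ = ℚP.+-monoʳ-≤ (f x) (sumℚ-filter-≤ 0≤f)
    ... | no _  = p≤q⇒p≤r+q 0≤fx (sumℚ-filter-≤ 0≤f)

-- Chosen so that DiagIn S σ unfolds to
-- 0 < σ × ∃ ws (SupportedIn S ws × mass ws ≡ 1 × ∀ j → σ · moment j ws ≤ 1).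
Weighting : ℕ → Set
Weighting n = List (ℚ × Exp n)

module _ {n : ℕ} where

  mass : Weighting n → ℚ
  mass ws = sumℚ (map proj₁ ws)

  term : Fin n → ℚ × Exp n → ℚ
  term j m = proj₁ m ℚ.* ℕ→ℚ (lookup (proj₂ m) j)

  moment : Fin n → Weighting n → ℚ
  moment j ws = sumℚ (map (term j) ws)

  term-nonNeg : ∀ j {m} → 0ℚ ℚ.≤ proj₁ m → 0ℚ ℚ.≤ term j m
  term-nonNeg j {m} 0≤λ = *-nonNeg 0≤λ (ℕ→ℚ-nonNeg (lookup (proj₂ m) j))

  SupportedIn : List (Exp n) → Weighting n → Set
  SupportedIn S ws = LAll (λ m → (0ℚ ℚ.≤ proj₁ m) × (proj₂ m ∈ S)) ws

  HasCoordinateIn : List (Fin n) → Exp n → Set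
  HasCoordinateIn js e = Any (λ j → 1 ≤ lookup e j) js

  rescale : ℚ → Weighting n → Weighting n
  rescale c = map (λ m → proj₁ m ℚ.* c , proj₂ m)

  mass-rescale : ∀ c ws → mass (rescale c ws) ≡ mass ws ℚ.* c
  mass-rescale c ws = trans (cong sumℚ (sym (ListP.map-∘ ws))) (sumℚ-map-*ʳ proj₁ c ws)

  moment-rescale : ∀ c j ws → moment j (rescale c ws) ≡ moment j ws ℚ.* c
  moment-rescale c j ws = begin
    moment j (rescale c ws)                                       ≡⟨ cong sumℚ (sym (ListP.map-∘ ws)) ⟩
    sumℚ (map (λ m → (proj₁ m ℚ.* c) ℚ.* coord m) ws)            ≡⟨ cong sumℚ (ListP.map-cong swap ws) ⟩
    sumℚ (map (λ m → (proj₁ m ℚ.* coord m) ℚ.* c) ws)            ≡⟨ sumℚ-map-*ʳ _ c ws ⟩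
    moment j ws ℚ.* c                                             ∎
    where
    open ≡-Reasoning
    coord : ℚ × Exp n → ℚ
    coord m = ℕ→ℚ (lookup (proj₂ m) j)
    swap : ∀ m → (proj₁ m ℚ.* c) ℚ.* coord m ≡ (proj₁ m ℚ.* coord m) ℚ.* c
    swap m = ℚ*.xy∙z≈xz∙y (proj₁ m) c (coord m)

  diagIn-normalise : ∀ {T σ} ws → 0ℚ ℚ.< σ → SupportedIn T ws → 0ℚ ℚ.< mass ws →
                     (∀ j → σ ℚ.* moment j ws ℚ.≤ 1ℚ) → DiagIn T (σ ℚ.* mass ws)
  diagIn-normalise {T} {σ} ws 0<σ ws⊆T 0<K σmoment≤1 =
    0<σK , rescale c ws , ws'⊆T , mass≡1 , σKmoment≤1
    where
    K : ℚ
    K = mass ws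
    instance
      K-pos : ℚ.Positive K
      K-pos = ℚ.positive 0<K
      K-nonZero : ℚ.NonZero K
      K-nonZero = ℚP.pos⇒nonZero K
      σ-pos : ℚ.Positive σ
      σ-pos = ℚ.positive 0<σ
    c : ℚ
    c = 1/ K
    0≤c : 0ℚ ℚ.≤ c
    0≤c = ℚP.<⇒≤ (ℚP.positive⁻¹ c {{ℚP.1/pos⇒pos K}})
    0<σK : 0ℚ ℚ.< σ ℚ.* K
    0<σK = ℚP.positive⁻¹ (σ ℚ.* K) {{ℚP.pos*pos⇒pos σ K}}
    ws'⊆T : SupportedIn T (rescale c ws)
    ws'⊆T = LAllP.map⁺ (LAll.map (λ (0≤λ , e∈T) → *-nonNeg 0≤λ 0≤c , e∈T) ws⊆T)
    mass≡1 : mass (rescale c ws) ≡ 1ℚ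
    mass≡1 = trans (mass-rescale c ws) (ℚP.*-inverseʳ K)
    σKmoment≤1 : ∀ j → (σ ℚ.* K) ℚ.* moment j (rescale c ws) ℚ.≤ 1ℚ
    σKmoment≤1 j = subst (ℚ._≤ 1ℚ) (sym σKmoment≡σmoment) (σmoment≤1 j)
      where
      open ≡-Reasoning
      σKmoment≡σmoment : (σ ℚ.* K) ℚ.* moment j (rescale c ws) ≡ σ ℚ.* moment j ws
      σKmoment≡σmoment = begin
        (σ ℚ.* K) ℚ.* moment j (rescale c ws)     ≡⟨ cong ((σ ℚ.* K) ℚ.*_) (moment-rescale c j ws) ⟩
        (σ ℚ.* K) ℚ.* (moment j ws ℚ.* c)         ≡⟨ ℚ*.interchange σ K (moment j ws) c ⟩
        (σ ℚ.* moment j ws) ℚ.* (K ℚ.* c)         ≡⟨ cong ((σ ℚ.* moment j ws) ℚ.*_) (ℚP.*-inverseʳ K) ⟩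
        (σ ℚ.* moment j ws) ℚ.* 1ℚ                ≡⟨ ℚP.*-identityʳ _ ⟩
        σ ℚ.* moment j ws                         ∎

  weight≤Σterms : ∀ m → 0ℚ ℚ.≤ proj₁ m → ∀ {js} → HasCoordinateIn js (proj₂ m) →
                  proj₁ m ℚ.≤ sumℚ (map (λ j → term j m) js)
  weight≤Σterms m 0≤λ {j ∷ js} (here 1≤eⱼ) =
    p≤q⇒p≤q+r (sumℚ-nonNeg _ {js} (LAll.tabulate λ {k} _ → term-nonNeg k {m} 0≤λ))
      (subst (ℚ._≤ term j m) (ℚP.*-identityʳ (proj₁ m))
        (ℚP.*-monoˡ-≤-nonNeg (proj₁ m) {{ℚ.nonNegative 0≤λ}} (1≤ℕ→ℚ 1≤eⱼ)))
  weight≤Σterms m 0≤λ {j ∷ js} (there hit) =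
    p≤q⇒p≤r+q (term-nonNeg j {m} 0≤λ) (weight≤Σterms m 0≤λ hit)

  mass≤Σmoment : ∀ js {ws} → LAll (λ m → (0ℚ ℚ.≤ proj₁ m) × HasCoordinateIn js (proj₂ m)) ws →
                 mass ws ℚ.≤ sumℚ (map (λ j → moment j ws) js)
  mass≤Σmoment js {[]}     [] = sumℚ-nonNeg _ {js} (LAll.tabulate λ _ → ℚP.≤-refl)
  mass≤Σmoment js {m ∷ ws} ((0≤λ , hit) ∷ hits) =
    subst (mass (m ∷ ws) ℚ.≤_) (sym (sumℚ-map-+ _ (λ j → moment j ws) js))
      (ℚP.+-mono-≤ (weight≤Σterms m 0≤λ hit) (mass≤Σmoment js hits))

sigmaLE-dropping : ∀ {n} {S T : List (Exp n)} (js : List (Fin n)) →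
                   (∀ {e} → e ∈ S → e ∉ T → HasCoordinateIn js e) →
                   SigmaLE S T (ℕ→ℚ (length js))
sigmaLE-dropping {n} {S} {T} js cover σ (0<σ , ws , ws⊆S , mass≡1 , σmoment≤1) =
  conclude (0ℚ ℚ.<? mass kept)
  where
  open DecMembership (VecP.≡-dec ℕP._≟_) using (_∈?_)

  k : ℚ
  k = ℕ→ℚ (length js)

  instance
    σ-nonNeg : ℚ.NonNegative σ
    σ-nonNeg = ℚ.nonNegative (ℚP.<⇒≤ 0<σ)

  inT? : Decidable (λ (m : ℚ × Exp n) → proj₂ m ∈ T)
  inT? m = proj₂ m ∈? T

  kept dropped : Weighting n
  kept    = filter inT? ws
  dropped = filter (¬? ∘ inT?) ws

  moment-filter-≤ : ∀ {P} (P? : Decidable P) j → moment j (filter P? ws) ℚ.≤ moment j ws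
  moment-filter-≤ P? j =
    sumℚ-filter-≤ P? (term j) (LAll.map (λ {m} (0≤λ , _) → term-nonNeg j {m} 0≤λ) ws⊆S)

  kept⊆S : SupportedIn S kept
  kept⊆S = LAllP.filter⁺ inT? ws⊆S

  kept⊆T : SupportedIn T kept
  kept⊆T = LAll.zipWith (λ ((0≤λ , _) , e∈T) → 0≤λ , e∈T) (kept⊆S , LAllP.all-filter inT? ws)

  σmoment-kept≤1 : ∀ j → σ ℚ.* moment j kept ℚ.≤ 1ℚ
  σmoment-kept≤1 j = ℚP.≤-trans (ℚP.*-monoˡ-≤-nonNeg σ (moment-filter-≤ inT? j)) (σmoment≤1 j)

  dropped-hits : LAll (λ m → (0ℚ ℚ.≤ proj₁ m) × HasCoordinateIn js (proj₂ m)) dropped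
  dropped-hits = LAll.zipWith (λ ((0≤λ , e∈S) , e∉T) → 0≤λ , cover e∈S e∉T)
                              (LAllP.filter⁺ (¬? ∘ inT?) ws⊆S , LAllP.all-filter (¬? ∘ inT?) ws)

  σ-split : σ ≡ σ ℚ.* mass kept ℚ.+ σ ℚ.* mass dropped
  σ-split = begin
    σ                                             ≡⟨ sym (ℚP.*-identityʳ σ) ⟩
    σ ℚ.* 1ℚ                                      ≡⟨ cong (σ ℚ.*_) (trans (sym mass≡1) (sumℚ-filter-split inT? proj₁ ws)) ⟩
    σ ℚ.* (mass kept ℚ.+ mass dropped)            ≡⟨ ℚP.*-distribˡ-+ σ (mass kept) (mass dropped) ⟩
    σ ℚ.* mass kept ℚ.+ σ ℚ.* mass dropped        ∎
    where open ≡-Reasoning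

  Σmoment-dropped≤ : sumℚ (map (λ j → moment j dropped) js) ℚ.≤ sumℚ (map (λ j → moment j ws) js)
  Σmoment-dropped≤ = sumℚ-mono-≤ {xs = js} (LAll.tabulate λ {j} _ → moment-filter-≤ (¬? ∘ inT?) j)

  σD≤k : σ ℚ.* mass dropped ℚ.≤ k
  σD≤k = begin
    σ ℚ.* mass dropped                            ≤⟨ ℚP.*-monoˡ-≤-nonNeg σ (mass≤Σmoment js dropped-hits) ⟩
    σ ℚ.* sumℚ (map (λ j → moment j dropped) js)  ≤⟨ ℚP.*-monoˡ-≤-nonNeg σ Σmoment-dropped≤ ⟩
    σ ℚ.* sumℚ (map (λ j → moment j ws) js)       ≤⟨ *-sumℚ≤length {c = σ} (λ j → moment j ws) σmoment≤1 js ⟩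
    k                                             ∎
    where open ℚP.≤-Reasoning

  conclude : Dec (0ℚ ℚ.< mass kept) → (σ ℚ.≤ k) ⊎ (∃ λ σ' → DiagIn T σ' × (σ ℚ.≤ σ' ℚ.+ k))
  conclude (yes 0<K) = inj₂ (σ ℚ.* mass kept , diagIn-normalise kept 0<σ kept⊆T 0<K σmoment-kept≤1 , σ≤σK+k)
    where
    σ≤σK+k : σ ℚ.≤ σ ℚ.* mass kept ℚ.+ k
    σ≤σK+k = subst (ℚ._≤ σ ℚ.* mass kept ℚ.+ k) (sym σ-split) (ℚP.+-monoʳ-≤ (σ ℚ.* mass kept) σD≤k)
  conclude (no ¬0<K) = inj₁ (subst (ℚ._≤ k) σD≡σ σD≤k)
    where
    open ≡-Reasoning
    K≡0 : mass kept ≡ 0ℚ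
    K≡0 = ℚP.≤-antisym (ℚP.≮⇒≥ ¬0<K) (sumℚ-nonNeg proj₁ (LAll.map proj₁ kept⊆S))
    σD≡σ : σ ℚ.* mass dropped ≡ σ
    σD≡σ = sym (begin
      σ                                          ≡⟨ σ-split ⟩
      σ ℚ.* mass kept ℚ.+ σ ℚ.* mass dropped     ≡⟨ cong (λ K → σ ℚ.* K ℚ.+ σ ℚ.* mass dropped) K≡0 ⟩
      σ ℚ.* 0ℚ ℚ.+ σ ℚ.* mass dropped            ≡⟨ cong (ℚ._+ σ ℚ.* mass dropped) (ℚP.*-zeroʳ σ) ⟩
      0ℚ ℚ.+ σ ℚ.* mass dropped                  ≡⟨ ℚP.+-identityˡ _ ⟩
      σ ℚ.* mass dropped                         ∎)

elements : ∀ {k} → Subset k → List (Fin k)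
elements Vec.[]            = []
elements (inside Vec.∷ p)  = Fin.zero ∷ map Fin.suc (elements p)
elements (outside Vec.∷ p) = map Fin.suc (elements p)

length-elements : ∀ {k} (p : Subset k) → length (elements p) ≡ ∣ p ∣
length-elements Vec.[]            = refl
length-elements (inside Vec.∷ p)  = cong suc (trans (ListP.length-map Fin.suc (elements p)) (length-elements p))
length-elements (outside Vec.∷ p) = trans (ListP.length-map Fin.suc (elements p)) (length-elements p)

∈-elements : ∀ {k} {p : Subset k} {i} → i Sub.∈ p → i ∈ elements p
∈-elements {p = inside Vec.∷ p}  Vec.here          = here refl
∈-elements {p = inside Vec.∷ p}  (Vec.there i∈p)  = there (∈P.∈-map⁺ Fin.suc (∈-elements i∈p))
∈-elements {p = outside Vec.∷ p} (Vec.there i∈p)  = ∈P.∈-map⁺ Fin.suc (∈-elements i∈p)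

isZeroVec-replicate : ∀ k → T (isZeroVec (replicate k 0))
isZeroVec-replicate ℕ.zero  = tt
isZeroVec-replicate (suc k) = isZeroVec-replicate k

isUnitAt-unitVec : ∀ {k} (i : Fin k) → T (isUnitAt i (unitVec i))
isUnitAt-unitVec {suc k} Fin.zero    = Equivalence.from BoolP.T-∧ (isZeroVec-replicate k , tt)
isUnitAt-unitVec {suc k} (Fin.suc i) = isUnitAt-unitVec i

∈-supp-filterᵇ : ∀ {K n} (p : Exp n → Bool) {ts : Terms K n} {e} →
                 e ∈ supp {K} ts → T (p e) → e ∈ supp {K} (filterᵇ (p ∘ proj₁) ts)
∈-supp-filterᵇ p e∈ts pe with ∈P.∈-map⁻ proj₁ e∈ts
... | m , m∈ts , refl = ∈P.∈-map⁺ proj₁ (∈P.∈-filter⁺ (T? ∘ p ∘ proj₁) m∈ts pe)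

module _ {K : FiniteField} {s t r : ℕ} (f : Poly K (s + t + r)) where

  private
    Expⁿ : Set
    Expⁿ = Exp (s + t + r)
    xpartⁿ : Expⁿ → Vec ℕ s
    xpartⁿ = xpart {s} {t} {r}
    h : Terms K (s + t + r)
    h = hTerms {K} {s} {t} {r} f
    gx : Fin s → Terms K (s + t + r)
    gx i = gxTerms {K} {s} {t} {r} i f

  xvar : Fin s → Fin (s + t + r)
  xvar i = Fin.inject≤ (Fin.inject≤ i (ℕP.m≤m+n s t)) (ℕP.m≤m+n (s + t) r)

  lookup-xvar : ∀ (e : Expⁿ) i → lookup e (xvar i) ≡ lookup (xpartⁿ e) i
  lookup-xvar e i = sym (trans (VecP.lookup-take-inject≤ (Vec.take (s + t) e) i)
                               (VecP.lookup-take-inject≤ e (Fin.inject≤ i (ℕP.m≤m+n s t))))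

  supp-h⊆supp-fI : ∀ I → supp {K} h ⊆ supp {K} (fI {K} {s} {t} {r} I f)
  supp-h⊆supp-fI I = ⊆P.map⁺ proj₁ (⊆P.xs⊆xs++ys _ _)

  supp-gx⊆supp-fI : ∀ I {i} → i Sub.∈ I → supp {K} (gx i) ⊆ supp {K} (fI {K} {s} {t} {r} I f)
  supp-gx⊆supp-fI I {i} i∈I = ⊆P.map⁺ proj₁ gx⊆fI
    where
    gx⊆fI : gx i ⊆ fI {K} {s} {t} {r} I f
    gx⊆fI {m} m∈gx = ∈P.∈-++⁺ʳ h (∈P.∈-concatMap⁺ _ (Any.map (λ { refl → selected }) (∈P.∈-allFin i)))
      where
      selected : m ∈ (if does (i SubP.∈? I) then gx i else [])
      selected = subst (λ b → m ∈ (if b then gx i else [])) (sym (dec-true (i SubP.∈? I) i∈I)) m∈gx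

  decomposition-cover : Decomposition {K} {s} {t} {r} f → (I : Subset s) {T : List Expⁿ} →
    supp {K} h ⊆ T → (∀ {i} → i Sub.∈ I → supp {K} (gx i) ⊆ T) →
    ∀ {e} → e ∈ supp {K} (Poly.terms f) → e ∉ T → HasCoordinateIn (map xvar (elements (∁ I))) e
  decomposition-cover (shape , _) I h⊆T gx⊆T {e} e∈f e∉T with LAll.lookup shape e∈f
  ... | inj₁ xe≡0 = contradiction (h⊆T e∈h) e∉T
    where
    e∈h : e ∈ supp {K} h
    e∈h = ∈-supp-filterᵇ {K} (isZeroVec ∘ xpartⁿ) e∈f
            (subst (T ∘ isZeroVec) (sym xe≡0) (isZeroVec-replicate s))
  ... | inj₂ (i , xe≡uᵢ , _) with i SubP.∈? I
  ...   | yes i∈I = contradiction (gx⊆T i∈I e∈gxᵢ) e∉T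
    where
    e∈gxᵢ : e ∈ supp {K} (gx i)
    e∈gxᵢ = ∈-supp-filterᵇ {K} (isUnitAt i ∘ xpartⁿ) e∈f
              (subst (T ∘ isUnitAt i) (sym xe≡uᵢ) (isUnitAt-unitVec i))
  ...   | no i∉I = AnyP.map⁺ (Any.map (λ { refl → 1≤eₓᵢ }) (∈-elements (SubP.x∉p⇒x∈∁p i∉I)))
    where
    1≤eₓᵢ : 1 ≤ lookup e (xvar i)
    1≤eₓᵢ = ℕP.≤-reflexive (sym (begin
      lookup e (xvar i)          ≡⟨ lookup-xvar e i ⟩
      lookup (xpartⁿ e) i        ≡⟨ cong (λ v → lookup v i) xe≡uᵢ ⟩
      lookup (unitVec i) i       ≡⟨ VecP.lookup∘update i (replicate s 0) 1 ⟩
      1                          ∎))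
      where open ≡-Reasoning

  sigmaLE-decomposition : Decomposition {K} {s} {t} {r} f → (I : Subset s) {T : List Expⁿ} →
    supp {K} h ⊆ T → (∀ {i} → i Sub.∈ I → supp {K} (gx i) ⊆ T) →
    SigmaLE (supp {K} (Poly.terms f)) T (ℕ→ℚ (s ∸ ∣ I ∣))
  sigmaLE-decomposition dec I h⊆T gx⊆T =
    subst (SigmaLE (supp {K} (Poly.terms f)) _ ∘ ℕ→ℚ) #xvars
      (sigmaLE-dropping (map xvar (elements (∁ I))) (decomposition-cover dec I h⊆T gx⊆T))
    where
    #xvars : length (map xvar (elements (∁ I))) ≡ s ∸ ∣ I ∣
    #xvars = trans (ListP.length-map xvar (elements (∁ I)))
                   (trans (length-elements (∁ I)) (SubP.∣∁p∣≡n∸∣p∣ I))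

lemma4p1 : (K : FiniteField) (s t r : ℕ) → 1 ≤ r →
  (f : Poly K (s + t + r)) → NonDegenerate f →
  (b : ℕ) (w : Vec ℕ t) → 0 < b → All (λ wj → (0 < wj) × (wj < b)) w →
  WeightedHomogeneous {K} {s} {t} {r} b w f →
  RMaximal {K} {s} {t} {r} f →
  CharNotDividing K b →
  Decomposition {K} {s} {t} {r} f →
  (I : Subset s) →
  SigmaLE (supp {K} (Poly.terms f)) (supp {K} (fI {K} {s} {t} {r} I f)) (ℕ→ℚ (s ∸ ∣ I ∣))
  × SigmaLE (supp {K} (Poly.terms f)) (supp {K} (hTerms {K} {s} {t} {r} f)) (ℕ→ℚ s)
lemma4p1 K s t r _ f _ _ _ _ _ _ _ _ dec I =
  sigmaLE-decomposition f dec I (supp-h⊆supp-fI f I) (supp-gx⊆supp-fI f I) ,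
  subst (SigmaLE (supp {K} (Poly.terms f)) (supp {K} (hTerms {K} {s} {t} {r} f)) ∘ ℕ→ℚ ∘ (s ∸_))
        (SubP.∣⊥∣≡0 s)
        (sigmaLE-decomposition f dec ⊥ ⊆P.⊆-refl (λ i∈⊥ → contradiction i∈⊥ SubP.∉⊥))
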